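{- There exist infinitely many $\mathrm{GL}_2(\mathbb{Z})$-classes of primitive ordinary integral binary quadratic forms whose discriminant is congruent to $5\pmod 8$.
   Context: A form $aX^2+bXY+cY^2$ with $a,b,c\in\mathbb{Z}$ is primitive if $\gcd(a,b,c)=1$; its discriminant is $b^2-4ac$. $\mathrm{GL}_2(\mathbb{Z})$ acts by linear substitution, and the orbit of $F$ is $[F]_{\mathrm{GL}_2(\mathbb{Z})}$. Let $[F]_{\mathrm{val}}$ be the set of integral forms $G$ with $G(\mathbb{Z}^2)=F(\mathbb{Z}^2)$. The form $F$ is ordinary if $[F]_{\mathrm{val}}=[F]_{\mathrm{GL}_2(\mathbb{Z})}$. -}

module Defs where

open import Data.Integer using (ℤ; +_; _+_; _*_; _-_; -_; 1ℤ)
open import Data.Integer.GCD using (gcd)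
open import Data.Product using (Σ; ∃; _×_; _,_)
open import Data.Sum using (_⊎_)
open import Relation.Binary.PropositionalEquality using (_≡_)

record Form : Set where
  constructor form
  field
    a b c : ℤ
open Form public

eval : Form → ℤ → ℤ → ℤ
eval (form a b c) x y = a * x * x + b * x * y + c * y * y

disc : Form → ℤ
disc (form a b c) = b * b - + 4 * a * c

Primitive : Form → Set
Primitive (form a b c) = gcd (gcd a b) c ≡ 1ℤ

record Mat : Set where
  constructor mat
  field
    p q r s : ℤ

det : Mat → ℤ
det (mat p q r s) = p * s - q * r

InGL2 : Mat → Set
InGL2 M = (det M ≡ 1ℤ) ⊎ (det M ≡ - 1ℤ)

Subst : Mat → Form → Form → Set
Subst (mat p q r s) F G =
  ∀ x y → eval G x y ≡ eval F (p * x + q * y) (r * x + s * y)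

GLEquiv : Form → Form → Set
GLEquiv F G = Σ Mat λ M → InGL2 M × Subst M F G

Represents : Form → ℤ → Set
Represents F m = ∃ λ x → ∃ λ y → eval F x y ≡ m

SameValues : Form → Form → Set
SameValues F G = ∀ m → (Represents G m → Represents F m) × (Represents F m → Represents G m)

Ordinary : Form → Set
Ordinary F = ∀ G → (SameValues F G → GLEquiv F G) × (GLEquiv F G → SameValues F G)

-- Take F = x² + xy + ky² with k = 3 + 4t: it is primitive, its discriminant −(11 + 16t) is
-- 5 (mod 8), and equivalent forms have equal discriminants, so a large t avoids the classes of
-- any finitely many given forms.
--
-- To see that F is ordinary, complete the square: the values of F below 4k − 1 are the squares
-- and the numbers k + n(n + 1). If G takes the same values, it represents 1 and is therefore
-- properly equivalent to some G′ = x² + exy + Cy² with e ∈ {0, 1}, which takes only values of F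
-- and represents k. As k − 1, k and k + 4 are 2 or 3 (mod 4), none of them is a square, and
-- comparing G′(0, 1) = C, G′(1, 1) = 1 + e + C, G′(2, 1) = 4 + 2e + C and the representation of
-- k with the values of F leaves only e = 1 and C = k, that is, G′ = F.

module Submission where

open import Defs
open import Data.Integer using (_%ℕ_)
open import Data.List using (List)
open import Data.List.Relation.Unary.All using (All)
open import Data.Product using (Σ; _×_)
open import Relation.Binary.PropositionalEquality using (_≡_)
open import Relation.Nullary using (¬_)

open import Data.Empty using (⊥; ⊥-elim)
open import Data.Integer
  using (ℤ; +_; -[1+_]; +[1+_]; _+_; _*_; _-_; -_; 0ℤ; 1ℤ; -1ℤ; ∣_∣; _≤_; _<_; +≤+; +<+; -<+; nonNegative; _/ℕ_)
open import Data.Integer.DivMod using (n%ℕd<d; a≡a%ℕn+[a/ℕn]*n)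
open import Data.Integer.GCD using (gcd; gcd-zeroˡ)
open import Data.Integer.Properties
open import Algebra.Properties.AbelianGroup +-0-abelianGroup using (∙-cancelˡ; ∙-cancelʳ)
open import Data.Integer.Tactic.RingSolver using (solve-∀; solve)
open import Data.List using (_∷_; []; map)
import Data.List.Relation.Unary.All as All
open import Data.Nat as ℕ using (ℕ; suc; z≤n; s≤s)
import Data.Nat.DivMod as ℕ
open import Data.Nat.ListAction using (sum)
import Data.Nat.Properties as ℕₚ
import Data.Nat.Tactic.RingSolver as ℕ-Solver
open import Data.Product using (∃; _,_; proj₁; proj₂)
open import Data.Sum using (_⊎_; inj₁; inj₂)
open import Function using (_∘_)
open import Relation.Binary.PropositionalEquality
open import Relation.Nullary using (contradiction; yes; no)

All-≤-sum : ∀ {A : Set} (f : A → ℕ) xs → All (λ x → f x ℕ.≤ sum (map f xs)) xs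
All-≤-sum f [] = All.[]
All-≤-sum f (x ∷ xs) =
  ℕₚ.m≤m+n (f x) _ All.∷ All.map (λ fy≤Σ → ℕₚ.≤-trans fy≤Σ (ℕₚ.m≤n+m _ (f x))) (All-≤-sum f xs)

IsSquare : ℤ → Set
IsSquare m = ∃ λ z → m ≡ z * z

n*n%4≤1 : ∀ n → n ℕ.* n ℕ.% 4 ℕ.≤ 1
n*n%4≤1 n = subst (ℕ._≤ 1) (sym (ℕ.%-distribˡ-* n n 4)) (r*r%4≤1 (n ℕ.% 4) (ℕ.m%n<n n 4))
  where
  r*r%4≤1 : ∀ r → r ℕ.< 4 → r ℕ.* r ℕ.% 4 ℕ.≤ 1
  r*r%4≤1 0 _ = z≤n
  r*r%4≤1 1 _ = ℕₚ.≤-refl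
  r*r%4≤1 2 _ = z≤n
  r*r%4≤1 3 _ = ℕₚ.≤-refl
  r*r%4≤1 (suc (suc (suc (suc _)))) (s≤s (s≤s (s≤s (s≤s ()))))

i*i≡+[∣i∣*∣i∣] : ∀ i → i * i ≡ + (∣ i ∣ ℕ.* ∣ i ∣)
i*i≡+[∣i∣*∣i∣] (+ n) = sym (pos-* n n)
i*i≡+[∣i∣*∣i∣] -[1+ n ] = refl

n≤∣i∣⇒n*n≤i*i : ∀ {n} i → n ℕ.≤ ∣ i ∣ → + (n ℕ.* n) ≤ i * i
n≤∣i∣⇒n*n≤i*i i n≤∣i∣ = subst (_ ≤_) (sym (i*i≡+[∣i∣*∣i∣] i)) (+≤+ (ℕₚ.*-mono-≤ n≤∣i∣ n≤∣i∣))

0≤i*i : ∀ i → 0ℤ ≤ i * i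
0≤i*i i = n≤∣i∣⇒n*n≤i*i i z≤n

¬IsSquare[r+q*4] : ∀ r q → 2 ℕ.≤ r → r ℕ.< 4 → ¬ IsSquare (+ (r ℕ.+ q ℕ.* 4))
¬IsSquare[r+q*4] r q 2≤r r<4 (z , n≡z*z) =
  ℕₚ.<⇒≱ 2≤n%4 (subst (λ m → m ℕ.% 4 ℕ.≤ 1) (sym n≡∣z∣*∣z∣) (n*n%4≤1 ∣ z ∣))
  where
  n≡∣z∣*∣z∣ : r ℕ.+ q ℕ.* 4 ≡ ∣ z ∣ ℕ.* ∣ z ∣
  n≡∣z∣*∣z∣ = +-injective (trans n≡z*z (i*i≡+[∣i∣*∣i∣] z))
  2≤n%4 : 2 ℕ.≤ (r ℕ.+ q ℕ.* 4) ℕ.% 4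
  2≤n%4 = subst (2 ℕ.≤_) (sym (trans (ℕ.[m+kn]%n≡m%n r q 4) (ℕ.m<n⇒m%n≡m r<4))) 2≤r

¬m*m≡n*n+d : ∀ m n d → 0 ℕ.< d → d ℕ.≤ 2 ℕ.* n → m ℕ.* m ≢ n ℕ.* n ℕ.+ d
¬m*m≡n*n+d m n d 0<d d≤2n m²≡n²+d with ℕₚ.≤-<-connex m n
... | inj₁ m≤n = ℕₚ.<⇒≱ (ℕₚ.m<m+n (n ℕ.* n) 0<d) (subst (ℕ._≤ n ℕ.* n) m²≡n²+d (ℕₚ.*-mono-≤ m≤n m≤n))
... | inj₂ n<m = ℕₚ.<⇒≱ n²+d<[n+1]² (subst (suc n ℕ.* suc n ℕ.≤_) m²≡n²+d (ℕₚ.*-mono-≤ n<m n<m))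
  where
  n²+d<[n+1]² : n ℕ.* n ℕ.+ d ℕ.< suc n ℕ.* suc n
  n²+d<[n+1]² = ℕₚ.≤-trans (s≤s (ℕₚ.+-monoʳ-≤ (n ℕ.* n) d≤2n)) (ℕₚ.≤-reflexive ([n+1]² n))
    where
    [n+1]² : ∀ n → suc (n ℕ.* n ℕ.+ 2 ℕ.* n) ≡ suc n ℕ.* suc n
    [n+1]² = ℕ-Solver.solve-∀

¬IsSquare[i*i+d] : ∀ i d → 0 ℕ.< d → d ℕ.≤ 2 ℕ.* ∣ i ∣ → ¬ IsSquare (i * i + + d)
¬IsSquare[i*i+d] i d 0<d d≤2∣i∣ (z , i²+d≡z²) =
  ¬m*m≡n*n+d ∣ z ∣ ∣ i ∣ d 0<d d≤2∣i∣ (+-injective (begin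
    + (∣ z ∣ ℕ.* ∣ z ∣)     ≡⟨ sym (i*i≡+[∣i∣*∣i∣] z) ⟩
    z * z                   ≡⟨ sym i²+d≡z² ⟩
    i * i + + d             ≡⟨ cong (_+ + d) (i*i≡+[∣i∣*∣i∣] i) ⟩
    + (∣ i ∣ ℕ.* ∣ i ∣ ℕ.+ d) ∎))
  where open ≡-Reasoning

0≤i*[i+1] : ∀ i → 0ℤ ≤ i * (i + 1ℤ)
0≤i*[i+1] (+ n) = subst (0ℤ ≤_) (pos-* n (n ℕ.+ 1)) (+≤+ z≤n)
0≤i*[i+1] -[1+ n ] = subst (0ℤ ≤_) (reflect -[1+ n ]) (0≤i*[i+1] (+ n))
  where
  reflect : ∀ i → (- i - 1ℤ) * (- i - 1ℤ + 1ℤ) ≡ i * (i + 1ℤ)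
  reflect = solve-∀

¬IsSquare[i*i+1+r] : ∀ i → 1 ℕ.≤ ∣ i ∣ → ∀ {r} → r ≡ 0ℤ ⊎ r ≡ 1ℤ → ¬ IsSquare (i * i + (1ℤ + r))
¬IsSquare[i*i+1+r] i 1≤∣i∣ (inj₁ refl) = ¬IsSquare[i*i+d] i 1 (s≤s z≤n) (ℕₚ.≤-trans 1≤∣i∣ (ℕₚ.m≤m+n _ _))
¬IsSquare[i*i+1+r] i 1≤∣i∣ (inj₂ refl) = ¬IsSquare[i*i+d] i 2 (s≤s z≤n) (ℕₚ.*-monoʳ-≤ 2 1≤∣i∣)

i*[i+1]≢4 : ∀ i → i * (i + 1ℤ) ≢ + 4
i*[i+1]≢4 i i*[i+1]≡4 = ¬IsSquare[i*i+d] (+ 4) 1 (s≤s z≤n) (s≤s z≤n) (+ 2 * i + 1ℤ , (begin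
  + 4 * + 4 + + 1                 ≡⟨ cong (λ p → + 4 * p + + 1) i*[i+1]≡4 ⟨
  + 4 * (i * (i + 1ℤ)) + + 1      ≡⟨ solve (i ∷ []) ⟩
  (+ 2 * i + 1ℤ) * (+ 2 * i + 1ℤ) ∎))
  where open ≡-Reasoning

i<i+j : ∀ i {j} → 0ℤ < j → i < i + j
i<i+j i {j} 0<j = subst (_< i + j) (+-identityʳ i) (+-monoʳ-< i 0<j)

j+[i-j]≡i : ∀ i j → j + (i - j) ≡ i
j+[i-j]≡i = solve-∀

i+j<i : ∀ i {j} → j < 0ℤ → i + j < i
i+j<i i {j} j<0 = subst (i + j <_) (+-identityʳ i) (+-monoʳ-< i j<0)

infixl 7 _·_

_·_ : Form → Mat → Form
form a b c · mat p q r s =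
  form (eval (form a b c) p r) (+ 2 * a * p * q + b * (p * s + q * r) + + 2 * c * r * s) (eval (form a b c) q s)

eval-· : ∀ F M x y → eval (F · M) x y ≡ eval F (Mat.p M * x + Mat.q M * y) (Mat.r M * x + Mat.s M * y)
eval-· (form a b c) (mat p q r s) x y = begin
  (a * p * p + b * p * r + c * r * r) * x * x
    + (+ 2 * a * p * q + b * (p * s + q * r) + + 2 * c * r * s) * x * y
    + (a * q * q + b * q * s + c * s * s) * y * y
    ≡⟨ solve (a ∷ b ∷ c ∷ p ∷ q ∷ r ∷ s ∷ x ∷ y ∷ []) ⟩
  a * (p * x + q * y) * (p * x + q * y) + b * (p * x + q * y) * (r * x + s * y)
    + c * (r * x + s * y) * (r * x + s * y) ∎
  where open ≡-Reasoning

disc-· : ∀ F M → disc (F · M) ≡ det M * det M * disc F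
disc-· (form a b c) (mat p q r s) = begin
  (+ 2 * a * p * q + b * (p * s + q * r) + + 2 * c * r * s) * (+ 2 * a * p * q + b * (p * s + q * r) + + 2 * c * r * s)
    - + 4 * (a * p * p + b * p * r + c * r * r) * (a * q * q + b * q * s + c * s * s)
    ≡⟨ solve (a ∷ b ∷ c ∷ p ∷ q ∷ r ∷ s ∷ []) ⟩
  (p * s - q * r) * (p * s - q * r) * (b * b - + 4 * a * c) ∎
  where open ≡-Reasoning

eval-1-0 : ∀ F → eval F 1ℤ 0ℤ ≡ a F
eval-1-0 (form a b c) = begin
  a * 1ℤ * 1ℤ + b * 1ℤ * 0ℤ + c * 0ℤ * 0ℤ ≡⟨ solve (a ∷ b ∷ c ∷ []) ⟩
  a                                       ∎
  where open ≡-Reasoning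

eval-0-1 : ∀ F → eval F 0ℤ 1ℤ ≡ c F
eval-0-1 (form a b c) = begin
  a * 0ℤ * 0ℤ + b * 0ℤ * 1ℤ + c * 1ℤ * 1ℤ ≡⟨ solve (a ∷ b ∷ c ∷ []) ⟩
  c                                       ∎
  where open ≡-Reasoning

eval-1-1 : ∀ F → eval F 1ℤ 1ℤ ≡ a F + b F + c F
eval-1-1 (form a b c) = begin
  a * 1ℤ * 1ℤ + b * 1ℤ * 1ℤ + c * 1ℤ * 1ℤ ≡⟨ solve (a ∷ b ∷ c ∷ []) ⟩
  a + b + c                               ∎
  where open ≡-Reasoning

form-ext : ∀ {F G} → (∀ x y → eval F x y ≡ eval G x y) → F ≡ G
form-ext {F@(form a b c)} {G@(form a′ b′ c′)} F≗G
  with trans (sym (eval-1-0 F)) (trans (F≗G 1ℤ 0ℤ) (eval-1-0 G))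
     | trans (sym (eval-0-1 F)) (trans (F≗G 0ℤ 1ℤ) (eval-0-1 G))
... | refl | refl = cong (λ b → form a b c) (∙-cancelˡ a b b′ (∙-cancelʳ c (a + b) (a + b′) a+b+c≡a+b′+c))
  where
  a+b+c≡a+b′+c : a + b + c ≡ a + b′ + c
  a+b+c≡a+b′+c = trans (sym (eval-1-1 F)) (trans (F≗G 1ℤ 1ℤ) (eval-1-1 G))

Subst⇒≡· : ∀ {M F G} → Subst M F G → G ≡ F · M
Subst⇒≡· {M} {F} G≗F∘M = form-ext λ x y → trans (G≗F∘M x y) (sym (eval-· F M x y))

Subst⇒Represents : ∀ {M F G m} → Subst M F G → Represents G m → Represents F m
Subst⇒Represents {mat p q r s} G≗F∘M (x , y , Gxy≡m) = p * x + q * y , r * x + s * y , trans (sym (G≗F∘M x y)) Gxy≡m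

det²≡1 : ∀ {M} → InGL2 M → det M * det M ≡ 1ℤ
det²≡1 (inj₁ det≡1) = cong (λ d → d * d) det≡1
det²≡1 (inj₂ det≡-1) = cong (λ d → d * d) det≡-1

-- The adjugate scaled by det M; it is M⁻¹ when det M = ±1.
inverse : Mat → Mat
inverse M@(mat p q r s) = mat (det M * s) (- (det M * q)) (- (det M * r)) (det M * p)

det-inverse : ∀ M → det (inverse M) ≡ det M * det M * det M
det-inverse (mat p q r s) = begin
  (p * s - q * r) * s * ((p * s - q * r) * p) - - ((p * s - q * r) * q) * - ((p * s - q * r) * r)
    ≡⟨ solve (p ∷ q ∷ r ∷ s ∷ []) ⟩
  (p * s - q * r) * (p * s - q * r) * (p * s - q * r) ∎
  where open ≡-Reasoning

InGL2-inverse : ∀ {M} → InGL2 M → InGL2 (inverse M)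
InGL2-inverse {M} (inj₁ det≡1) = inj₁ (trans (det-inverse M) (cong (λ d → d * d * d) det≡1))
InGL2-inverse {M} (inj₂ det≡-1) = inj₂ (trans (det-inverse M) (cong (λ d → d * d * d) det≡-1))

Subst-inverse : ∀ {M F G} → det M * det M ≡ 1ℤ → Subst M F G → Subst (inverse M) G F
Subst-inverse {mat p q r s} {F} {G} d²≡1 G≗F∘M x y = begin
  eval F x y                                  ≡⟨ cong₂ (eval F) (sym x′-cancels) (sym y′-cancels) ⟩
  eval F (p * x′ + q * y′) (r * x′ + s * y′)  ≡⟨ sym (G≗F∘M x′ y′) ⟩
  eval G x′ y′                                ∎
  where
  open ≡-Reasoning
  x′ y′ : ℤ
  x′ = (p * s - q * r) * s * x + - ((p * s - q * r) * q) * y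
  y′ = - ((p * s - q * r) * r) * x + (p * s - q * r) * p * y
  x′-cancels : p * x′ + q * y′ ≡ x
  x′-cancels = begin
    p * ((p * s - q * r) * s * x + - ((p * s - q * r) * q) * y)
      + q * (- ((p * s - q * r) * r) * x + (p * s - q * r) * p * y)
      ≡⟨ solve (p ∷ q ∷ r ∷ s ∷ x ∷ y ∷ []) ⟩
    (p * s - q * r) * (p * s - q * r) * x ≡⟨ cong (_* x) d²≡1 ⟩
    1ℤ * x                                ≡⟨ *-identityˡ x ⟩
    x                                     ∎
  y′-cancels : r * x′ + s * y′ ≡ y
  y′-cancels = begin
    r * ((p * s - q * r) * s * x + - ((p * s - q * r) * q) * y)
      + s * (- ((p * s - q * r) * r) * x + (p * s - q * r) * p * y)
      ≡⟨ solve (p ∷ q ∷ r ∷ s ∷ x ∷ y ∷ []) ⟩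
    (p * s - q * r) * (p * s - q * r) * y ≡⟨ cong (_* y) d²≡1 ⟩
    1ℤ * y                                ≡⟨ *-identityˡ y ⟩
    y                                     ∎

GLEquiv-sym : ∀ {F G} → GLEquiv F G → GLEquiv G F
GLEquiv-sym {F} {G} (M , M∈GL2 , G≗F∘M) =
  inverse M , InGL2-inverse {M} M∈GL2 , Subst-inverse {M} {F} {G} (det²≡1 {M} M∈GL2) G≗F∘M

GLEquiv⇒SameValues : ∀ {F G} → GLEquiv F G → SameValues F G
GLEquiv⇒SameValues {F} {G} (M , M∈GL2 , G≗F∘M) m =
  Subst⇒Represents {M} {F} {G} {m} G≗F∘M ,
  Subst⇒Represents {inverse M} {G} {F} {m} (Subst-inverse {M} {F} {G} (det²≡1 {M} M∈GL2) G≗F∘M)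

GLEquiv⇒disc≡ : ∀ {F G} → GLEquiv F G → disc G ≡ disc F
GLEquiv⇒disc≡ {F} {G} (M , M∈GL2 , G≗F∘M) = begin
  disc G                      ≡⟨ cong disc (Subst⇒≡· {M} {F} {G} G≗F∘M) ⟩
  disc (F · M)                ≡⟨ disc-· F M ⟩
  det M * det M * disc F      ≡⟨ cong (_* disc F) (det²≡1 {M} M∈GL2) ⟩
  1ℤ * disc F                 ≡⟨ *-identityˡ (disc F) ⟩
  disc F                      ∎
  where open ≡-Reasoning

Values⊆ : Form → Form → Set
Values⊆ G F = ∀ m → Represents G m → Represents F m

Primitive-[1,b,c] : ∀ b c → Primitive (form 1ℤ b c)
Primitive-[1,b,c] b c = trans (cong (λ g → gcd g c) (gcd-zeroˡ b)) (gcd-zeroˡ c)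

-- Every `completion t` has first column (x₀, y₀) and determinant G(x₀, y₀) = 1, and the
-- middle coefficient of G · completion t is B + 2t, so a suitable t brings it to 0 or 1.
represents-1⇒GLEquiv-[1,e,C] : ∀ G → Represents G 1ℤ →
  ∃ λ e → ∃ λ C → (e ≡ 0ℤ ⊎ e ≡ 1ℤ) × GLEquiv G (form 1ℤ e C)
represents-1⇒GLEquiv-[1,e,C] G@(form a b c) (x₀ , y₀ , G[x₀,y₀]≡1) =
  + (B %ℕ 2) , Form.c (G · N) , bit (B %ℕ 2) (n%ℕd<d B 2) , N , inj₁ det-N , Subst-N
  where
  open ≡-Reasoning
  completion : ℤ → Mat
  completion t = mat x₀ (x₀ * t - c * y₀) y₀ (y₀ * t + a * x₀ + b * y₀)

  det-completion : ∀ t → det (completion t) ≡ eval G x₀ y₀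
  det-completion t = begin
    x₀ * (y₀ * t + a * x₀ + b * y₀) - (x₀ * t - c * y₀) * y₀ ≡⟨ solve (a ∷ b ∷ c ∷ x₀ ∷ y₀ ∷ t ∷ []) ⟩
    a * x₀ * x₀ + b * x₀ * y₀ + c * y₀ * y₀                  ∎

  B : ℤ
  B = + 2 * a * x₀ * (- (c * y₀)) + b * (x₀ * (a * x₀ + b * y₀) - c * y₀ * y₀) + + 2 * c * y₀ * (a * x₀ + b * y₀)

  middle-completion : ∀ t → Form.b (G · completion t) ≡ B + + 2 * t * eval G x₀ y₀
  middle-completion t = begin
    + 2 * a * x₀ * (x₀ * t - c * y₀) + b * (x₀ * (y₀ * t + a * x₀ + b * y₀) + (x₀ * t - c * y₀) * y₀)
      + + 2 * c * y₀ * (y₀ * t + a * x₀ + b * y₀)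
      ≡⟨ solve (a ∷ b ∷ c ∷ x₀ ∷ y₀ ∷ t ∷ []) ⟩
    + 2 * a * x₀ * (- (c * y₀)) + b * (x₀ * (a * x₀ + b * y₀) - c * y₀ * y₀) + + 2 * c * y₀ * (a * x₀ + b * y₀)
      + + 2 * t * (a * x₀ * x₀ + b * x₀ * y₀ + c * y₀ * y₀) ∎

  N : Mat
  N = completion (- (B /ℕ 2))

  det-N : det N ≡ 1ℤ
  det-N = trans (det-completion _) G[x₀,y₀]≡1

  middle-N : Form.b (G · N) ≡ + (B %ℕ 2)
  middle-N = begin
    Form.b (G · N)                                        ≡⟨ middle-completion _ ⟩
    B + + 2 * - (B /ℕ 2) * eval G x₀ y₀                   ≡⟨ cong (λ v → B + + 2 * - (B /ℕ 2) * v) G[x₀,y₀]≡1 ⟩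
    B + + 2 * - (B /ℕ 2) * 1ℤ                             ≡⟨ cong (λ v → v + + 2 * - (B /ℕ 2) * 1ℤ) (a≡a%ℕn+[a/ℕn]*n B 2) ⟩
    + (B %ℕ 2) + (B /ℕ 2) * + 2 + + 2 * - (B /ℕ 2) * 1ℤ  ≡⟨ cancel (+ (B %ℕ 2)) (B /ℕ 2) ⟩
    + (B %ℕ 2)                                            ∎
    where
    cancel : ∀ r q → r + q * + 2 + + 2 * - q * 1ℤ ≡ r
    cancel = solve-∀

  Subst-N : Subst N G (form 1ℤ (+ (B %ℕ 2)) (Form.c (G · N)))
  Subst-N = subst (Subst N G) (cong₂ (λ a′ b′ → form a′ b′ (Form.c (G · N))) G[x₀,y₀]≡1 middle-N) (eval-· G N)

  bit : ∀ r → r ℕ.< 2 → + r ≡ 0ℤ ⊎ + r ≡ 1ℤ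
  bit 0 _ = inj₁ refl
  bit 1 _ = inj₂ refl
  bit (suc (suc _)) (s≤s (s≤s ()))

-disc*y²≤4a*eval : ∀ F x y → - disc F * (y * y) ≤ + 4 * a F * eval F x y
-disc*y²≤4a*eval (form a b c) x y = begin
  - (b * b - + 4 * a * c) * (y * y)         ≤⟨ i≤j+i _ (u * u) {{nonNegative (0≤i*i u)}} ⟩
  u * u + - (b * b - + 4 * a * c) * (y * y) ≡⟨ completing-square ⟩
  + 4 * a * (a * x * x + b * x * y + c * y * y) ∎
  where
  open ≤-Reasoning
  u = + 2 * a * x + b * y
  completing-square : (+ 2 * a * x + b * y) * (+ 2 * a * x + b * y) + - (b * b - + 4 * a * c) * (y * y)
                      ≡ + 4 * a * (a * x * x + b * x * y + c * y * y)
  completing-square = solve (a ∷ b ∷ c ∷ x ∷ y ∷ [])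

-disc≤4a*eval : ∀ F x y → 0ℤ ≤ - disc F → 1 ℕ.≤ ∣ y ∣ → - disc F ≤ + 4 * a F * eval F x y
-disc≤4a*eval F x y 0≤-disc 1≤∣y∣ = begin
  - disc F               ≡⟨ *-identityʳ (- disc F) ⟨
  - disc F * 1ℤ          ≤⟨ *-monoˡ-≤-nonNeg (- disc F) {{nonNegative 0≤-disc}} (n≤∣i∣⇒n*n≤i*i y 1≤∣y∣) ⟩
  - disc F * (y * y)     ≤⟨ -disc*y²≤4a*eval F x y ⟩
  + 4 * a F * eval F x y ∎
  where open ≤-Reasoning

-- 4 (x² + xy + ky²) = (2x + y)² + (4k − 1) y²: the value is a square if y = 0, of the form
-- k + n(n + 1) if y = ±1, and at least 4k − 1 if |y| ≥ 2.
PrincipalValue : ℤ → ℤ → Set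
PrincipalValue k m = IsSquare m ⊎ (∃ λ n → m ≡ k + n * (n + 1ℤ)) ⊎ (+ 4 * k - 1ℤ ≤ m)

-disc[1,1,k] : ∀ k → - disc (form 1ℤ 1ℤ k) ≡ + 4 * k - 1ℤ
-disc[1,1,k] k = begin
  - (1ℤ * 1ℤ - + 4 * 1ℤ * k) ≡⟨ solve (k ∷ []) ⟩
  + 4 * k - 1ℤ               ∎
  where open ≡-Reasoning

2≤∣y∣⇒4k-1≤eval : ∀ k → 0ℤ ≤ + 4 * k - 1ℤ → ∀ x y → 2 ℕ.≤ ∣ y ∣ →
                  + 4 * k - 1ℤ ≤ eval (form 1ℤ 1ℤ k) x y
2≤∣y∣⇒4k-1≤eval k 0≤4k-1 x y 2≤∣y∣ = *-cancelˡ-≤-pos (+ 4 * k - 1ℤ) (eval F x y) (+ 4) (begin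
  + 4 * (+ 4 * k - 1ℤ)     ≡⟨ *-comm (+ 4) _ ⟩
  (+ 4 * k - 1ℤ) * + 4     ≤⟨ *-monoˡ-≤-nonNeg (+ 4 * k - 1ℤ) {{nonNegative 0≤4k-1}} (n≤∣i∣⇒n*n≤i*i y 2≤∣y∣) ⟩
  (+ 4 * k - 1ℤ) * (y * y) ≡⟨ cong (_* (y * y)) (-disc[1,1,k] k) ⟨
  - disc F * (y * y)       ≤⟨ -disc*y²≤4a*eval F x y ⟩
  + 4 * eval F x y         ∎)
  where
  open ≤-Reasoning
  F = form 1ℤ 1ℤ k

principal-values : ∀ k → 0ℤ ≤ + 4 * k - 1ℤ → ∀ x y → PrincipalValue k (eval (form 1ℤ 1ℤ k) x y)
principal-values k _ x (+ 0) = inj₁ (x , (begin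
  1ℤ * x * x + 1ℤ * x * 0ℤ + k * 0ℤ * 0ℤ ≡⟨ solve (k ∷ x ∷ []) ⟩
  x * x                                  ∎))
  where open ≡-Reasoning
principal-values k _ x (+ 1) = inj₂ (inj₁ (x , (begin
  1ℤ * x * x + 1ℤ * x * 1ℤ + k * 1ℤ * 1ℤ ≡⟨ solve (k ∷ x ∷ []) ⟩
  k + x * (x + 1ℤ)                       ∎)))
  where open ≡-Reasoning
principal-values k _ x -[1+ 0 ] = inj₂ (inj₁ (- x , (begin
  1ℤ * x * x + 1ℤ * x * -1ℤ + k * -1ℤ * -1ℤ ≡⟨ solve (k ∷ x ∷ []) ⟩
  k + - x * (- x + 1ℤ)                      ∎)))
  where open ≡-Reasoning
principal-values k 0≤4k-1 x y@(+[1+ suc _ ]) = inj₂ (inj₂ (2≤∣y∣⇒4k-1≤eval k 0≤4k-1 x y (s≤s (s≤s z≤n))))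
principal-values k 0≤4k-1 x y@(-[1+ suc _ ]) = inj₂ (inj₂ (2≤∣y∣⇒4k-1≤eval k 0≤4k-1 x y (s≤s (s≤s z≤n))))

-- k is a variable equal to 3 + 4t, rather than that expression, so that the ring solver can use it.
module _ {t : ℕ} {k : ℤ} (k≡3+4t : k ≡ + (3 ℕ.+ t ℕ.* 4)) where

  ¬IsSquare-k : ¬ IsSquare k
  ¬IsSquare-k rewrite k≡3+4t = ¬IsSquare[r+q*4] 3 t (s≤s (s≤s z≤n)) ℕₚ.≤-refl

  ¬IsSquare-k-1 : ¬ IsSquare (k - 1ℤ)
  ¬IsSquare-k-1 rewrite k≡3+4t = ¬IsSquare[r+q*4] 2 t ℕₚ.≤-refl (s≤s (s≤s (s≤s z≤n)))

  0≤4k-1 : 0ℤ ≤ + 4 * k - 1ℤ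
  0≤4k-1 rewrite k≡3+4t = +≤+ z≤n

  0≤4k : 0ℤ ≤ + 4 * k
  0≤4k rewrite k≡3+4t = +≤+ z≤n

  4k-1≡11+16t : + 4 * k - 1ℤ ≡ + (11 ℕ.+ t ℕ.* 16)
  4k-1≡11+16t rewrite k≡3+4t = cong (λ n → + n - 1ℤ) (4[3+4t]≡12+16t t)
    where
    4[3+4t]≡12+16t : ∀ t → 4 ℕ.* (3 ℕ.+ t ℕ.* 4) ≡ 12 ℕ.+ t ℕ.* 16
    4[3+4t]≡12+16t = ℕ-Solver.solve-∀

  k+4<4k-1 : k + + 4 < + 4 * k - 1ℤ
  k+4<4k-1 = subst₂ _<_ (sym k+4≡) (sym 4k-1≡11+16t) (+<+ 7+4t<11+16t)
    where
    k+4≡ : k + + 4 ≡ + (7 ℕ.+ t ℕ.* 4)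
    k+4≡ rewrite k≡3+4t = cong +_ (e t)
      where
      e : ∀ t → 3 ℕ.+ t ℕ.* 4 ℕ.+ 4 ≡ 7 ℕ.+ t ℕ.* 4
      e = ℕ-Solver.solve-∀
    7+4t<11+16t : 7 ℕ.+ t ℕ.* 4 ℕ.< 11 ℕ.+ t ℕ.* 16
    7+4t<11+16t = ℕₚ.+-mono-<-≤ (ℕₚ.m<m+n 7 (s≤s z≤n)) (ℕₚ.*-monoʳ-≤ t (ℕₚ.m≤m+n 4 12))

  k+4∉ : ¬ PrincipalValue k (k + + 4)
  k+4∉ (inj₁ k+4-square) = ¬IsSquare-k+4 k+4-square
    where
    ¬IsSquare-k+4 : ¬ IsSquare (k + + 4)
    ¬IsSquare-k+4 rewrite k≡3+4t =
      subst (λ n → ¬ IsSquare (+ n)) (e t) (¬IsSquare[r+q*4] 3 (suc t) (s≤s (s≤s z≤n)) ℕₚ.≤-refl)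
      where
      e : ∀ t → 3 ℕ.+ suc t ℕ.* 4 ≡ 3 ℕ.+ t ℕ.* 4 ℕ.+ 4
      e = ℕ-Solver.solve-∀
  k+4∉ (inj₂ (inj₁ (n , k+4≡k+n[n+1]))) = i*[i+1]≢4 n (sym (∙-cancelˡ k (+ 4) _ k+4≡k+n[n+1]))
  k+4∉ (inj₂ (inj₂ 4k-1≤k+4)) = <⇒≱ k+4<4k-1 4k-1≤k+4

  value<k⇒IsSquare : ∀ {m} → PrincipalValue k m → m < k → IsSquare m
  value<k⇒IsSquare (inj₁ m-square) _ = m-square
  value<k⇒IsSquare (inj₂ (inj₁ (n , m≡k+n[n+1]))) m<k =
    contradiction (subst (k ≤_) (sym m≡k+n[n+1]) (i≤i+j k _ {{nonNegative (0≤i*[i+1] n)}})) (<⇒≱ m<k)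
  value<k⇒IsSquare (inj₂ (inj₂ 4k-1≤m)) m<k =
    contradiction 4k-1≤m (<⇒≱ (<-trans m<k (<-trans (i<i+j k (+<+ (s≤s z≤n))) k+4<4k-1)))

  private
    Fₖ : Form
    Fₖ = form 1ℤ 1ℤ k

  principal-value : ∀ G → Values⊆ G Fₖ → ∀ x y → PrincipalValue k (eval G x y)
  principal-value G G⊆Fₖ x y with G⊆Fₖ _ (x , y , refl)
  ... | x′ , y′ , Fₖ[x′,y′]≡G[x,y] =
    subst (PrincipalValue k) Fₖ[x′,y′]≡G[x,y] (principal-values k 0≤4k-1 x′ y′)

  k<C⇒4k<-disc : ∀ {r C} u → C ≡ k + +[1+ u ] → r ≡ 0ℤ ⊎ r ≡ 1ℤ → + 4 * k < - disc (form 1ℤ r C)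
  k<C⇒4k<-disc {r} u refl r∈01 = begin-strict
    + 4 * k                                  <⟨ i<i+j (+ 4 * k) (0<4-r² r∈01) ⟩
    + 4 * k + (+ 4 - r * r)                  ≤⟨ i≤i+j _ (+ 4 * + u) {{nonNegative 0≤4u}} ⟩
    + 4 * k + (+ 4 - r * r) + + 4 * + u      ≡⟨ expand r k (+ u) ⟨
    - (r * r - + 4 * 1ℤ * (k + (1ℤ + + u))) ∎
    where
    open ≤-Reasoning
    0<4-r² : ∀ {r} → r ≡ 0ℤ ⊎ r ≡ 1ℤ → 0ℤ < + 4 - r * r
    0<4-r² (inj₁ refl) = +<+ (s≤s z≤n)
    0<4-r² (inj₂ refl) = +<+ (s≤s z≤n)
    0≤4u : 0ℤ ≤ + 4 * + u
    0≤4u = subst (0ℤ ≤_) (pos-* 4 u) (+≤+ z≤n)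
    expand : ∀ r k U → - (r * r - + 4 * 1ℤ * (k + (1ℤ + U))) ≡ + 4 * k + (+ 4 - r * r) + + 4 * U
    expand = solve-∀

  k<C⇒eval≢k : ∀ {r C} u → C ≡ k + +[1+ u ] → r ≡ 0ℤ ⊎ r ≡ 1ℤ →
               ∀ x y → 1 ℕ.≤ ∣ y ∣ → eval (form 1ℤ r C) x y ≢ k
  k<C⇒eval≢k {r} {C} u C≡ r∈01 x y 1≤∣y∣ G[x,y]≡k = <-irrefl refl (begin-strict
    + 4 * k          <⟨ 4k<-disc ⟩
    - disc G         ≤⟨ -disc≤4a*eval G x y (<⇒≤ (≤-<-trans 0≤4k 4k<-disc)) 1≤∣y∣ ⟩
    + 4 * eval G x y ≡⟨ cong (+ 4 *_) G[x,y]≡k ⟩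
    + 4 * k          ∎)
    where
    open ≤-Reasoning
    G = form 1ℤ r C
    4k<-disc = k<C⇒4k<-disc u C≡ r∈01

  k<C⇒¬represents-k : ∀ {r C} u → C ≡ k + +[1+ u ] → r ≡ 0ℤ ⊎ r ≡ 1ℤ → ¬ Represents (form 1ℤ r C) k
  k<C⇒¬represents-k {r} {C} u C≡ r∈01 (x , + 0 , G[x,0]≡k) = ¬IsSquare-k (x , (begin
    k                                      ≡⟨ G[x,0]≡k ⟨
    1ℤ * x * x + r * x * 0ℤ + C * 0ℤ * 0ℤ  ≡⟨ solve (r ∷ C ∷ x ∷ []) ⟩
    x * x                                  ∎))
    where open ≡-Reasoning
  k<C⇒¬represents-k u C≡ r∈01 (x , y@(+[1+ _ ]) , G[x,y]≡k) = k<C⇒eval≢k u C≡ r∈01 x y (s≤s z≤n) G[x,y]≡k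
  k<C⇒¬represents-k u C≡ r∈01 (x , y@(-[1+ _ ]) , G[x,y]≡k) = k<C⇒eval≢k u C≡ r∈01 x y (s≤s z≤n) G[x,y]≡k

  C<k⇒IsSquare : ∀ {r C} w → C ≡ k + -[1+ w ] → Values⊆ (form 1ℤ r C) Fₖ → IsSquare C
  C<k⇒IsSquare {r} {C} w C≡ G⊆Fₖ = value<k⇒IsSquare
    (subst (PrincipalValue k) (eval-0-1 (form 1ℤ r C)) (principal-value (form 1ℤ r C) G⊆Fₖ 0ℤ 1ℤ))
    (subst (_< k) (sym C≡) (i+j<i k -<+))

  1+r+C<k⇒IsSquare : ∀ r C → Values⊆ (form 1ℤ r C) Fₖ → 1ℤ + r + C < k → IsSquare (1ℤ + r + C)
  1+r+C<k⇒IsSquare r C G⊆Fₖ = value<k⇒IsSquare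
    (subst (PrincipalValue k) (eval-1-1 (form 1ℤ r C)) (principal-value (form 1ℤ r C) G⊆Fₖ 1ℤ 1ℤ))

  C≡0⇒1+r+C≮k : ∀ {r C} → r ≡ 0ℤ ⊎ r ≡ 1ℤ → Values⊆ (form 1ℤ r C) Fₖ → Represents (form 1ℤ r C) k →
                C ≡ 0ℤ → 1ℤ + r + C < k → ⊥
  C≡0⇒1+r+C≮k {C = C} (inj₁ refl) _ (x , y , G[x,y]≡k) C≡0 _ = ¬IsSquare-k (x , (begin
    k                                       ≡⟨ G[x,y]≡k ⟨
    1ℤ * x * x + 0ℤ * x * y + C * y * y     ≡⟨ cong (λ C → 1ℤ * x * x + 0ℤ * x * y + C * y * y) C≡0 ⟩
    1ℤ * x * x + 0ℤ * x * y + 0ℤ * y * y    ≡⟨ solve (x ∷ y ∷ []) ⟩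
    x * x                                   ∎))
    where open ≡-Reasoning
  C≡0⇒1+r+C≮k {C = C} (inj₂ refl) G⊆Fₖ _ C≡0 2+C<k = ¬IsSquare[r+q*4] 2 0 ℕₚ.≤-refl (s≤s (s≤s (s≤s z≤n)))
    (subst (λ C → IsSquare (1ℤ + 1ℤ + C)) C≡0 (1+r+C<k⇒IsSquare 1ℤ C G⊆Fₖ 2+C<k))

  C≡z²⇒1+r+C≮k : ∀ {r C} → r ≡ 0ℤ ⊎ r ≡ 1ℤ → Values⊆ (form 1ℤ r C) Fₖ → Represents (form 1ℤ r C) k →
                 ∀ z → C ≡ z * z → 1ℤ + r + C < k → ⊥
  C≡z²⇒1+r+C≮k {r} {C} r∈01 G⊆Fₖ G-rep-k z C≡z² 1+r+C<k with ∣ z ∣ ℕ.≟ 0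
  ... | yes ∣z∣≡0 =
    C≡0⇒1+r+C≮k r∈01 G⊆Fₖ G-rep-k (trans C≡z² (cong (λ z → z * z) (∣i∣≡0⇒i≡0 {z} ∣z∣≡0))) 1+r+C<k
  ... | no ∣z∣≢0 = ¬IsSquare[i*i+1+r] z (ℕₚ.n≢0⇒n>0 ∣z∣≢0) r∈01
    (subst IsSquare (trans (cong (λ C → 1ℤ + r + C) C≡z²) (+-comm (1ℤ + r) (z * z)))
      (1+r+C<k⇒IsSquare r C G⊆Fₖ 1+r+C<k))

  C≡k+D⇒1+r+C<k : ∀ r {C D} → C ≡ k + D → 1ℤ + r + D < 0ℤ → 1ℤ + r + C < k
  C≡k+D⇒1+r+C<k r {C} {D} refl 1+r+D<0 = subst (_< k) (sym (shift r k D)) (i+j<i k 1+r+D<0)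
    where
    shift : ∀ r k D → 1ℤ + r + (k + D) ≡ k + (1ℤ + r + D)
    shift = solve-∀

  2r+C≢k : ∀ r C → Values⊆ (form 1ℤ r C) Fₖ → + 2 * r + C ≢ k
  2r+C≢k r C G⊆Fₖ 2r+C≡k =
    k+4∉ (subst (PrincipalValue k) G[2,1]≡k+4 (principal-value (form 1ℤ r C) G⊆Fₖ (+ 2) 1ℤ))
    where
    open ≡-Reasoning
    G[2,1]≡k+4 : eval (form 1ℤ r C) (+ 2) 1ℤ ≡ k + + 4
    G[2,1]≡k+4 = begin
      1ℤ * + 2 * + 2 + r * + 2 * 1ℤ + C * 1ℤ * 1ℤ ≡⟨ solve (r ∷ C ∷ []) ⟩
      + 2 * r + C + + 4                          ≡⟨ cong (_+ + 4) 2r+C≡k ⟩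
      k + + 4                                    ∎

  C<k⇒¬represents-k : ∀ {r C} w → C ≡ k + -[1+ w ] → r ≡ 0ℤ ⊎ r ≡ 1ℤ → Values⊆ (form 1ℤ r C) Fₖ →
                      ¬ Represents (form 1ℤ r C) k
  C<k⇒¬represents-k {r} {C} 0 C≡k-1 _ G⊆Fₖ _ =
    ¬IsSquare-k-1 (subst IsSquare C≡k-1 (C<k⇒IsSquare {r} {C} 0 C≡k-1 G⊆Fₖ))
  C<k⇒¬represents-k {C = C} 1 C≡k-2 (inj₂ refl) G⊆Fₖ _ = 2r+C≢k 1ℤ C G⊆Fₖ (begin
    + 2 * 1ℤ + C         ≡⟨ cong (λ C → + 2 * 1ℤ + C) C≡k-2 ⟩
    + 2 * 1ℤ + (k - + 2) ≡⟨ solve (k ∷ []) ⟩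
    k                    ∎)
    where open ≡-Reasoning
  C<k⇒¬represents-k {C = C} (suc w) C≡ (inj₁ refl) G⊆Fₖ G-rep-k =
    let z , C≡z² = C<k⇒IsSquare {0ℤ} {C} (suc w) C≡ G⊆Fₖ in
    C≡z²⇒1+r+C≮k {0ℤ} {C} (inj₁ refl) G⊆Fₖ G-rep-k z C≡z² (C≡k+D⇒1+r+C<k 0ℤ C≡ -<+)
  C<k⇒¬represents-k {C = C} (suc (suc w)) C≡ (inj₂ refl) G⊆Fₖ G-rep-k =
    let z , C≡z² = C<k⇒IsSquare {1ℤ} {C} (suc (suc w)) C≡ G⊆Fₖ in
    C≡z²⇒1+r+C≮k {1ℤ} {C} (inj₂ refl) G⊆Fₖ G-rep-k z C≡z² (C≡k+D⇒1+r+C<k 1ℤ C≡ -<+)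

  [1,r,C]≡Fₖ : ∀ {r C} → r ≡ 0ℤ ⊎ r ≡ 1ℤ → Values⊆ (form 1ℤ r C) Fₖ → Represents (form 1ℤ r C) k →
               form 1ℤ r C ≡ Fₖ
  [1,r,C]≡Fₖ {r} {C} r∈01 G⊆Fₖ G-rep-k with C - k | sym (j+[i-j]≡i C k)
  ... | -[1+ w ] | C≡ = ⊥-elim (C<k⇒¬represents-k w C≡ r∈01 G⊆Fₖ G-rep-k)
  ... | +[1+ u ] | C≡ = ⊥-elim (k<C⇒¬represents-k u C≡ r∈01 G-rep-k)
  ... | + 0      | C≡ with r∈01
  ...   | inj₂ refl = cong (form 1ℤ 1ℤ) (trans C≡ (+-identityʳ k))
  ...   | inj₁ refl = ⊥-elim (2r+C≢k 0ℤ C G⊆Fₖ (trans (+-identityˡ C) (trans C≡ (+-identityʳ k))))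

  x²+xy+ky²-ordinary : Ordinary Fₖ
  x²+xy+ky²-ordinary G = SameValues⇒GLEquiv , GLEquiv⇒SameValues {Fₖ} {G}
    where
    Fₖ-rep-1 : Represents Fₖ 1ℤ
    Fₖ-rep-1 = 1ℤ , 0ℤ , eval-1-0 Fₖ
    Fₖ-rep-k : Represents Fₖ k
    Fₖ-rep-k = 0ℤ , 1ℤ , eval-0-1 Fₖ
    SameValues⇒GLEquiv : SameValues Fₖ G → GLEquiv Fₖ G
    SameValues⇒GLEquiv Fₖ≈G =
      let e , C , e∈01 , G~G′ = represents-1⇒GLEquiv-[1,e,C] G (proj₂ (Fₖ≈G 1ℤ) Fₖ-rep-1)
          G′≈G = GLEquiv⇒SameValues {G} {form 1ℤ e C} G~G′
          G′⊆Fₖ = λ m → proj₁ (Fₖ≈G m) ∘ proj₁ (G′≈G m)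
          G′≡Fₖ = [1,r,C]≡Fₖ {e} {C} e∈01 G′⊆Fₖ (proj₂ (G′≈G k) (proj₂ (Fₖ≈G k) Fₖ-rep-k))
      in GLEquiv-sym {G} {Fₖ} (subst (GLEquiv G) G′≡Fₖ G~G′)

principal : ℕ → Form
principal t = form 1ℤ 1ℤ (+ (3 ℕ.+ t ℕ.* 4))

principal-ordinary : ∀ t → Ordinary (principal t)
principal-ordinary t = x²+xy+ky²-ordinary {t} refl

disc-principal : ∀ t → disc (principal t) ≡ -[1+ (10 ℕ.+ t ℕ.* 16) ]
disc-principal t = begin
  disc (principal t)                  ≡⟨ neg-involutive _ ⟨
  - (- disc (principal t))            ≡⟨ cong -_ (-disc[1,1,k] (+ (3 ℕ.+ t ℕ.* 4))) ⟩
  - (+ 4 * + (3 ℕ.+ t ℕ.* 4) - 1ℤ)   ≡⟨ cong -_ (4k-1≡11+16t {t} refl) ⟩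
  - + (11 ℕ.+ t ℕ.* 16)               ∎
  where open ≡-Reasoning

disc-principal%8 : ∀ t → disc (principal t) %ℕ 8 ≡ 5
disc-principal%8 t = trans (cong (_%ℕ 8) (disc-principal t)) (-[1+n]%8 {10 ℕ.+ t ℕ.* 16} [11+16t]%8≡3)
  where
  -[1+n]%8 : ∀ {n} → suc n ℕ.% 8 ≡ 3 → -[1+ n ] %ℕ 8 ≡ 5
  -[1+n]%8 suc[n]%8≡3 rewrite suc[n]%8≡3 = refl
  [11+16t]%8≡3 : (11 ℕ.+ t ℕ.* 16) ℕ.% 8 ≡ 3
  [11+16t]%8≡3 = trans (cong (ℕ._% 8) (e t)) (ℕ.[m+kn]%n≡m%n 3 (1 ℕ.+ t ℕ.* 2) 8)
    where
    e : ∀ t → 11 ℕ.+ t ℕ.* 16 ≡ 3 ℕ.+ (1 ℕ.+ t ℕ.* 2) ℕ.* 8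
    e = ℕ-Solver.solve-∀

∣disc∣≤t⇒¬GLEquiv : ∀ t G → ∣ disc G ∣ ℕ.≤ t → ¬ GLEquiv G (principal t)
∣disc∣≤t⇒¬GLEquiv t G ∣disc∣≤t G~P = ℕₚ.<⇒≱ t<11+16t (begin
  11 ℕ.+ t ℕ.* 16     ≡⟨ cong ∣_∣ (trans (sym (disc-principal t)) (GLEquiv⇒disc≡ {G} {principal t} G~P)) ⟩
  ∣ disc G ∣          ≤⟨ ∣disc∣≤t ⟩
  t                   ∎)
  where
  open ℕₚ.≤-Reasoning
  t<11+16t : t ℕ.< 11 ℕ.+ t ℕ.* 16
  t<11+16t = ℕₚ.+-mono-≤ (s≤s z≤n) (ℕₚ.m≤m*n t 16)

theorem1p14 : (L : List Form) →
    Σ Form λ F → Primitive F × Ordinary F × (disc F %ℕ 8 ≡ 5) × All (λ G → ¬ GLEquiv G F) L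
theorem1p14 L =
  principal t , Primitive-[1,b,c] 1ℤ (+ (3 ℕ.+ t ℕ.* 4)) , principal-ordinary t , disc-principal%8 t ,
  All.map (λ {G} → ∣disc∣≤t⇒¬GLEquiv t G) (All-≤-sum (λ G → ∣ disc G ∣) L)
  where
  t = sum (map (λ G → ∣ disc G ∣) L)
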